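{- For all integers $n\ge 3$, $$G^{(c)}_{n}(m,r,s)=G^{(s)}_{n}(m,r,s)+rs\left(G^{(s)}_{n-2}(m,rs,s)-G^{(c)}_{n-1}(m,rs,s)\right).$$
   Context: For a subset $S\subseteq\{1,\dots,n\}$ let $|S|$ be its size and $\sigma(S)=\sum_{i\in S}i$. Segment: with $c(S)$ the number of maximal runs of consecutive integers in $S$, $G_n^{(s)}(m,r,s)=\sum_{S\subseteq\{1,\dots,n\}} s^{\sigma(S)}r^{|S|}m^{c(S)}(m-1)^{|S|-c(S)}$ ($G_0^{(s)}=1$). Circle: for $n\ge3$ regard positions $1,\dots,n$ cyclically (positions $n$ and $1$ adjacent; position $i$ is the edge between vertices $i$ and $i+1$ of an $n$-cycle, indices mod $n$), and set $$G_n^{(c)}(m,r,s)=\sum_{S\subseteq\{1,\dots,n\}} s^{\sigma(S)}r^{|S|}P_S(m),$$ where $P_S(m)=m^{c_o(S)}(m-1)^{|S|-c_o(S)}$ if $S\neq\{1,\dots,n\}$, with $c_o(S)$ the number of maximal cyclic runs of consecutive positions in $S$, and $P_S(m)=(m-1)^n+(-1)^n(m-1)$ if $S=\{1,\dots,n\}$. (For positive integer $m$, $P_S(m)$ is the number of colorings of the dimers with $m$ colors such that adjacent dimers have different colors.) For $n\le 2$, set $G_n^{(c)}(m,r,s):=G_n^{(s)}(m,r,s)$. -}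

module Defs where

open import Data.Bool using (Bool; true; false; if_then_else_; not; _∧_)
open import Data.Nat as ℕ using (ℕ; zero; suc; _∸_)
open import Data.Integer using (ℤ; +_; _+_; _*_; _-_; -_; _^_; 0ℤ; 1ℤ)
open import Data.Vec using (Vec; []; _∷_; last)
open import Data.List as L using (List)

-- A subset S ⊆ {1,…,n} is a vector of n booleans; entry i (0-based) says
-- whether the element i+1 belongs to S.

allSubsets : (n : ℕ) → List (Vec Bool n)
allSubsets zero = L.[ [] ]
allSubsets (suc n) =
  L.map (false ∷_) (allSubsets n) L.++ L.map (true ∷_) (allSubsets n)

size : ∀ {n} → Vec Bool n → ℕ
size [] = 0
size (b ∷ v) = (if b then 1 else 0) ℕ.+ size v

sigmaFrom : ∀ {n} → ℕ → Vec Bool n → ℕ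
sigmaFrom k [] = 0
sigmaFrom k (b ∷ v) = (if b then suc k else 0) ℕ.+ sigmaFrom (suc k) v

sigma : ∀ {n} → Vec Bool n → ℕ
sigma = sigmaFrom 0

-- number of run starts (element in S whose predecessor, given by p, is not in S)
runsAfter : ∀ {n} → Bool → Vec Bool n → ℕ
runsAfter p [] = 0
runsAfter p (b ∷ v) = (if b ∧ not p then 1 else 0) ℕ.+ runsAfter b v

runs : ∀ {n} → Vec Bool n → ℕ
runs = runsAfter false

-- c_o(S): maximal cyclic runs (predecessor of position 1 is position n);
-- only used when S ≠ {1,…,n}
cycRuns : ∀ {n} → Vec Bool n → ℕ
cycRuns [] = 0
cycRuns v@(_ ∷ _) = runsAfter (last v) v

allTrue : ∀ {n} → Vec Bool n → Bool
allTrue [] = true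
allTrue (b ∷ v) = b ∧ allTrue v

sumℤ : List ℤ → ℤ
sumℤ = L.foldr _+_ 0ℤ

Gs : ℕ → ℤ → ℤ → ℤ → ℤ
Gs n m r s = sumℤ (L.map term (allSubsets n))
  where
  term : Vec Bool n → ℤ
  term S = (s ^ sigma S) * (r ^ size S) * (m ^ runs S) * ((m - 1ℤ) ^ (size S ∸ runs S))

PS : ∀ {n} → ℤ → Vec Bool n → ℤ
PS {n} m S =
  if allTrue S
  then (m - 1ℤ) ^ n + ((- 1ℤ) ^ n) * (m - 1ℤ)
  else (m ^ cycRuns S) * ((m - 1ℤ) ^ (size S ∸ cycRuns S))

Gc : ℕ → ℤ → ℤ → ℤ → ℤ
Gc 0 m r s = Gs 0 m r s
Gc 1 m r s = Gs 1 m r s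
Gc 2 m r s = Gs 2 m r s
Gc n@(suc (suc (suc _))) m r s = sumℤ (L.map term (allSubsets n))
  where
  term : Vec Bool n → ℤ
  term S = (s ^ sigma S) * (r ^ size S) * PS m S

-- Write each summand as a product over the elements i of S, where i contributes
-- s ^ i * r times m if it starts a run and m - 1 otherwise. On the cycle the
-- element 1 is preceded by n, so away from the full set the cycle sum is the
-- segment sum corrected on the sets containing n; for those sets, cycle and
-- segment weights differ only in the factor of 1 when 1 ∈ S. Deleting 1 and
-- moving every position down by one turns the difference into the same kind of
-- sum on n - 2 positions with r replaced by r * s, and the same comparison on
-- n - 1 positions expresses it through G^(s)_{n-2} and G^(c)_{n-1}.

module Submission where

open import Defs
open import Data.Nat using (ℕ; _≤_; _∸_)
open import Data.Integer using (ℤ; _+_; _*_; _-_)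
open import Relation.Binary.PropositionalEquality using (_≡_)

open import Algebra.Properties.CommutativeSemigroup using (interchange)
open import Data.Bool using (Bool; true; false; if_then_else_)
open import Data.Bool.Properties using (if-float)
import Data.Nat as ℕ
open import Data.Nat using (zero; suc; s≤s; z≤n)
open import Data.Nat.Properties using (m≤n⇒m≤1+n; +-∸-assoc)
open import Data.Integer using (-_; _^_; 0ℤ; 1ℤ)
open import Data.Integer.Properties
  using (+-identityˡ; +-identityʳ; +-assoc; +-commutativeSemigroup; *-zeroʳ; *-assoc; *-distribˡ-+; ^-distribˡ-+-*)
open import Data.Integer.Tactic.RingSolver using (solve-∀)
import Data.List as L
open import Data.List.Properties using (map-++; map-∘; map-cong)
open import Data.Vec using (Vec; []; _∷_; last; _∷ʳ_; replicate)
open import Data.Vec.Properties using (last-∷ʳ)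
open import Function using (_∘_)
open import Relation.Binary.PropositionalEquality
  using (refl; sym; trans; cong; cong₂; module ≡-Reasoning)

sumℤ-++ : ∀ xs ys → sumℤ (xs L.++ ys) ≡ sumℤ xs + sumℤ ys
sumℤ-++ L.[] ys = sym (+-identityˡ _)
sumℤ-++ (x L.∷ xs) ys = trans (cong (x +_) (sumℤ-++ xs ys)) (sym (+-assoc x _ _))

sumℤ-*ˡ : ∀ c xs → sumℤ (L.map (c *_) xs) ≡ c * sumℤ xs
sumℤ-*ˡ c L.[] = sym (*-zeroʳ c)
sumℤ-*ˡ c (x L.∷ xs) = trans (cong (c * x +_) (sumℤ-*ˡ c xs)) (sym (*-distribˡ-+ c x _))

∑ : (n : ℕ) → (Vec Bool n → ℤ) → ℤ
∑ n f = sumℤ (L.map f (allSubsets n))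

∑-cong : ∀ n {f g : Vec Bool n → ℤ} → (∀ S → f S ≡ g S) → ∑ n f ≡ ∑ n g
∑-cong n f≗g = cong sumℤ (map-cong f≗g (allSubsets n))

∑-*ˡ : ∀ n c (f : Vec Bool n → ℤ) → ∑ n (λ S → c * f S) ≡ c * ∑ n f
∑-*ˡ n c f = trans (cong sumℤ (map-∘ (allSubsets n))) (sumℤ-*ˡ c (L.map f (allSubsets n)))

∑-head : ∀ n f → ∑ (suc n) f ≡ ∑ n (f ∘ (false ∷_)) + ∑ n (f ∘ (true ∷_))
∑-head n f = begin
    sumℤ (L.map f (L.map (false ∷_) S L.++ L.map (true ∷_) S))
  ≡⟨ cong sumℤ (map-++ f (L.map (false ∷_) S) _) ⟩
    sumℤ (L.map f (L.map (false ∷_) S) L.++ L.map f (L.map (true ∷_) S))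
  ≡⟨ sumℤ-++ (L.map f (L.map (false ∷_) S)) _ ⟩
    sumℤ (L.map f (L.map (false ∷_) S)) + sumℤ (L.map f (L.map (true ∷_) S))
  ≡⟨ sym (cong₂ _+_ (cong sumℤ (map-∘ S)) (cong sumℤ (map-∘ S))) ⟩
    ∑ n (f ∘ (false ∷_)) + ∑ n (f ∘ (true ∷_))
  ∎
  where open ≡-Reasoning
        S = allSubsets n

∑-last : ∀ n f → ∑ (suc n) f ≡ ∑ n (λ u → f (u ∷ʳ false)) + ∑ n (λ u → f (u ∷ʳ true))
∑-last zero f = cong (_+ (f (true ∷ []) + 0ℤ)) (sym (+-identityʳ (f (false ∷ []))))
∑-last (suc n) f = begin
    ∑ (suc (suc n)) f
  ≡⟨ ∑-head (suc n) f ⟩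
    ∑ (suc n) (f ∘ (false ∷_)) + ∑ (suc n) (f ∘ (true ∷_))
  ≡⟨ cong₂ _+_ (∑-last n (f ∘ (false ∷_))) (∑-last n (f ∘ (true ∷_))) ⟩
    (∑ n (λ u → f (false ∷ (u ∷ʳ false))) + ∑ n (λ u → f (false ∷ (u ∷ʳ true))))
      + (∑ n (λ u → f (true ∷ (u ∷ʳ false))) + ∑ n (λ u → f (true ∷ (u ∷ʳ true))))
  ≡⟨ interchange +-commutativeSemigroup (∑ n (λ u → f (false ∷ (u ∷ʳ false)))) (∑ n (λ u → f (false ∷ (u ∷ʳ true))))
                 (∑ n (λ u → f (true ∷ (u ∷ʳ false)))) (∑ n (λ u → f (true ∷ (u ∷ʳ true)))) ⟩
    (∑ n (λ u → f (false ∷ (u ∷ʳ false))) + ∑ n (λ u → f (true ∷ (u ∷ʳ false))))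
      + (∑ n (λ u → f (false ∷ (u ∷ʳ true))) + ∑ n (λ u → f (true ∷ (u ∷ʳ true))))
  ≡⟨ sym (cong₂ _+_ (∑-head n (λ u → f (u ∷ʳ false))) (∑-head n (λ u → f (u ∷ʳ true)))) ⟩
    ∑ (suc n) (λ u → f (u ∷ʳ false)) + ∑ (suc n) (λ u → f (u ∷ʳ true))
  ∎
  where open ≡-Reasoning

full : ∀ n → Vec Bool n
full n = replicate n true

∑-if-allTrue : ∀ n (X Y : Vec Bool n → ℤ) →
  ∑ n (λ S → if allTrue S then X S else Y S) ≡ ∑ n Y + (X (full n) - Y (full n))
∑-if-allTrue zero X Y = lemma (X []) (Y [])
  where lemma : ∀ x y → x + 0ℤ ≡ (y + 0ℤ) + (x - y)
        lemma = solve-∀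
∑-if-allTrue (suc n) X Y = begin
    ∑ (suc n) (λ S → if allTrue S then X S else Y S)
  ≡⟨ ∑-head n _ ⟩
    ∑ n (Y ∘ (false ∷_)) + ∑ n (λ S → if allTrue S then X (true ∷ S) else Y (true ∷ S))
  ≡⟨ cong (∑ n (Y ∘ (false ∷_)) +_) (∑-if-allTrue n (X ∘ (true ∷_)) (Y ∘ (true ∷_))) ⟩
    ∑ n (Y ∘ (false ∷_)) + (∑ n (Y ∘ (true ∷_)) + (X (full (suc n)) - Y (full (suc n))))
  ≡⟨ sym (+-assoc (∑ n (Y ∘ (false ∷_))) _ _) ⟩
    (∑ n (Y ∘ (false ∷_)) + ∑ n (Y ∘ (true ∷_))) + (X (full (suc n)) - Y (full (suc n)))
  ≡⟨ cong (_+ (X (full (suc n)) - Y (full (suc n)))) (sym (∑-head n Y)) ⟩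
    ∑ (suc n) Y + (X (full (suc n)) - Y (full (suc n)))
  ∎
  where open ≡-Reasoning

-- The entries of S sit at positions k+1, …, k+n; p says whether position k is in S.
weight : ∀ {n} (m r s : ℤ) → ℕ → Bool → Vec Bool n → ℤ
weight m r s k p [] = 1ℤ
weight m r s k p (false ∷ S) = weight m r s (suc k) false S
weight m r s k p (true ∷ S) = s ^ suc k * r * (if p then m - 1ℤ else m) * weight m r s (suc k) true S

runsAfter≤size : ∀ {n} p (S : Vec Bool n) → runsAfter p S ≤ size S
runsAfter≤size p [] = z≤n
runsAfter≤size p (false ∷ S) = runsAfter≤size false S
runsAfter≤size false (true ∷ S) = s≤s (runsAfter≤size true S)
runsAfter≤size true (true ∷ S) = m≤n⇒m≤1+n (runsAfter≤size true S)

term≡weight : ∀ {n} m r s k p (S : Vec Bool n) →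
  s ^ sigmaFrom k S * r ^ size S * m ^ runsAfter p S * (m - 1ℤ) ^ (size S ∸ runsAfter p S)
    ≡ weight m r s k p S
term≡weight m r s k p [] = refl
term≡weight m r s k p (false ∷ S) = term≡weight m r s (suc k) false S
term≡weight m r s k false (true ∷ S) = begin
    s ^ (suc k ℕ.+ σ) * (r * r ^ size S) * (m * m ^ c) * (m - 1ℤ) ^ (size S ∸ c)
  ≡⟨ cong (λ z → z * (r * r ^ size S) * (m * m ^ c) * (m - 1ℤ) ^ (size S ∸ c)) (^-distribˡ-+-* s (suc k) σ) ⟩
    s ^ suc k * s ^ σ * (r * r ^ size S) * (m * m ^ c) * (m - 1ℤ) ^ (size S ∸ c)
  ≡⟨ rearrange (s ^ suc k) (s ^ σ) r (r ^ size S) m (m ^ c) ((m - 1ℤ) ^ (size S ∸ c)) ⟩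
    s ^ suc k * r * m * (s ^ σ * r ^ size S * m ^ c * (m - 1ℤ) ^ (size S ∸ c))
  ≡⟨ cong (s ^ suc k * r * m *_) (term≡weight m r s (suc k) true S) ⟩
    s ^ suc k * r * m * weight m r s (suc k) true S
  ∎
  where open ≡-Reasoning
        σ = sigmaFrom (suc k) S
        c = runsAfter true S
        rearrange : ∀ a b x y u v w → a * b * (x * y) * (u * v) * w ≡ a * x * u * (b * y * v * w)
        rearrange = solve-∀
term≡weight m r s k true (true ∷ S) = begin
    s ^ (suc k ℕ.+ σ) * (r * r ^ size S) * m ^ c * (m - 1ℤ) ^ (suc (size S) ∸ c)
  ≡⟨ cong₂ (λ z e → z * (r * r ^ size S) * m ^ c * (m - 1ℤ) ^ e)
           (^-distribˡ-+-* s (suc k) σ) (+-∸-assoc 1 (runsAfter≤size true S)) ⟩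
    s ^ suc k * s ^ σ * (r * r ^ size S) * m ^ c * ((m - 1ℤ) * (m - 1ℤ) ^ (size S ∸ c))
  ≡⟨ rearrange (s ^ suc k) (s ^ σ) r (r ^ size S) (m ^ c) (m - 1ℤ) ((m - 1ℤ) ^ (size S ∸ c)) ⟩
    s ^ suc k * r * (m - 1ℤ) * (s ^ σ * r ^ size S * m ^ c * (m - 1ℤ) ^ (size S ∸ c))
  ≡⟨ cong (s ^ suc k * r * (m - 1ℤ) *_) (term≡weight m r s (suc k) true S) ⟩
    s ^ suc k * r * (m - 1ℤ) * weight m r s (suc k) true S
  ∎
  where open ≡-Reasoning
        σ = sigmaFrom (suc k) S
        c = runsAfter true S
        rearrange : ∀ a b x y u v w → a * b * (x * y) * u * (v * w) ≡ a * x * v * (b * y * u * w)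
        rearrange = solve-∀

weight-*s : ∀ {n} m r s k p (S : Vec Bool n) → weight m (r * s) s k p S ≡ weight m r s (suc k) p S
weight-*s m r s k p [] = refl
weight-*s m r s k p (false ∷ S) = weight-*s m r s (suc k) false S
weight-*s m r s k p (true ∷ S) =
  trans (cong (s ^ suc k * (r * s) * (if p then m - 1ℤ else m) *_) (weight-*s m r s (suc k) true S))
        (rearrange (s ^ suc k) r s (if p then m - 1ℤ else m) _)
  where rearrange : ∀ a x y u w → a * (x * y) * u * w ≡ y * a * x * u * w
        rearrange = solve-∀

weight-∷ʳ-false : ∀ {n} m r s k p (S : Vec Bool n) → weight m r s k p (S ∷ʳ false) ≡ weight m r s k p S
weight-∷ʳ-false m r s k p [] = refl
weight-∷ʳ-false m r s k p (false ∷ S) = weight-∷ʳ-false m r s (suc k) false S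
weight-∷ʳ-false m r s k p (true ∷ S) =
  cong (s ^ suc k * r * (if p then m - 1ℤ else m) *_) (weight-∷ʳ-false m r s (suc k) true S)

Gs≡∑weight : ∀ n m r s → Gs n m r s ≡ ∑ n (weight m r s 0 false)
Gs≡∑weight n m r s = ∑-cong n (term≡weight m r s 0 false)

fullMonomial : ℤ → ℤ → ℕ → ℕ → ℤ
fullMonomial r s k zero = 1ℤ
fullMonomial r s k (suc n) = s ^ suc k * r * fullMonomial r s (suc k) n

fullMonomial-*s : ∀ r s k n → fullMonomial (r * s) s k n ≡ fullMonomial r s (suc k) n
fullMonomial-*s r s k zero = refl
fullMonomial-*s r s k (suc n) =
  trans (cong (s ^ suc k * (r * s) *_) (fullMonomial-*s r s (suc k) n)) (rearrange (s ^ suc k) r s _)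
  where rearrange : ∀ a x y w → a * (x * y) * w ≡ y * a * x * w
        rearrange = solve-∀

monomial-full : ∀ r s k n → s ^ sigmaFrom k (full n) * r ^ size (full n) ≡ fullMonomial r s k n
monomial-full r s k zero = refl
monomial-full r s k (suc n) = begin
    s ^ (suc k ℕ.+ σ) * (r * r ^ size (full n))
  ≡⟨ cong (_* (r * r ^ size (full n))) (^-distribˡ-+-* s (suc k) σ) ⟩
    s ^ suc k * s ^ σ * (r * r ^ size (full n))
  ≡⟨ rearrange (s ^ suc k) (s ^ σ) r (r ^ size (full n)) ⟩
    s ^ suc k * r * (s ^ σ * r ^ size (full n))
  ≡⟨ cong (s ^ suc k * r *_) (monomial-full r s (suc k) n) ⟩
    s ^ suc k * r * fullMonomial r s (suc k) n
  ∎
  where open ≡-Reasoning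
        σ = sigmaFrom (suc k) (full n)
        rearrange : ∀ a b x y → a * b * (x * y) ≡ a * x * (b * y)
        rearrange = solve-∀

weight-full : ∀ m r s k n → weight m r s k true (full n) ≡ fullMonomial r s k n * (m - 1ℤ) ^ n
weight-full m r s k zero = refl
weight-full m r s k (suc n) =
  trans (cong (s ^ suc k * r * (m - 1ℤ) *_) (weight-full m r s (suc k) n))
        (rearrange (s ^ suc k * r) (m - 1ℤ) _ _)
  where rearrange : ∀ a u f e → a * u * (f * e) ≡ a * f * (u * e)
        rearrange = solve-∀

last-full : ∀ n → last (full (suc n)) ≡ true
last-full zero = refl
last-full (suc n) = last-full n

-- The cycle sum on N + 1 positions, for every N; Gc agrees with it from three positions on.
Gcyc : ℕ → ℤ → ℤ → ℤ → ℤ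
Gcyc N m r s = ∑ (suc N) (λ S → s ^ sigma S * r ^ size S * PS m S)

cycleCorrection : ℕ → ℤ → ℤ → ℤ → ℤ
cycleCorrection n m r s = fullMonomial r s 0 n * ((- 1ℤ) ^ n * (m - 1ℤ))

cycleCorrection-suc : ∀ n m r s →
  cycleCorrection (suc n) m r s ≡ - (r * s) * cycleCorrection n m (r * s) s
cycleCorrection-suc n m r s =
  trans (cong (λ f → s ^ 1 * r * f * ((- 1ℤ) ^ suc n * (m - 1ℤ))) (sym (fullMonomial-*s r s 0 n)))
        (rearrange m r s (fullMonomial (r * s) s 0 n) ((- 1ℤ) ^ n))
  where rearrange : ∀ m r s f e → s * 1ℤ * r * f * (- 1ℤ * e * (m - 1ℤ)) ≡ - (r * s) * (f * (e * (m - 1ℤ)))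
        rearrange = solve-∀

-- Away from S = {1, …, N+1} the cycle summand is the segment weight with the
-- last position as predecessor of the first; the full set only adds the correction.
Gcyc≡∑weight : ∀ N m r s →
  Gcyc N m r s ≡ ∑ (suc N) (λ S → weight m r s 0 (last S) S) + cycleCorrection (suc N) m r s
Gcyc≡∑weight N m r s = begin
    Gcyc N m r s
  ≡⟨ ∑-cong (suc N) (λ S → if-float (monomial S *_) (allTrue S)) ⟩
    ∑ (suc N) (λ S → if allTrue S then X S else Y S)
  ≡⟨ ∑-if-allTrue (suc N) X Y ⟩
    ∑ (suc N) Y + (X (full (suc N)) - Y (full (suc N)))
  ≡⟨ cong₂ _+_ (∑-cong (suc N) Y≡weight) correction ⟩
    ∑ (suc N) (λ S → weight m r s 0 (last S) S) + cycleCorrection (suc N) m r s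
  ∎
  where
  open ≡-Reasoning
  monomial : Vec Bool (suc N) → ℤ
  monomial S = s ^ sigma S * r ^ size S
  fullColourings : ℤ
  fullColourings = (m - 1ℤ) ^ suc N + (- 1ℤ) ^ suc N * (m - 1ℤ)
  X Y : Vec Bool (suc N) → ℤ
  X S = monomial S * fullColourings
  Y S = monomial S * (m ^ cycRuns S * (m - 1ℤ) ^ (size S ∸ cycRuns S))
  Y≡weight : ∀ S → Y S ≡ weight m r s 0 (last S) S
  Y≡weight S@(_ ∷ _) = trans (sym (*-assoc (monomial S) _ _)) (term≡weight m r s 0 (last S) S)
  F = fullMonomial r s 0 (suc N)
  correction : X (full (suc N)) - Y (full (suc N)) ≡ cycleCorrection (suc N) m r s
  correction = begin
      X (full (suc N)) - Y (full (suc N))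
    ≡⟨ cong₂ (λ a b → a * fullColourings - b) (monomial-full r s 0 (suc N)) (Y≡weight (full (suc N))) ⟩
      F * fullColourings - weight m r s 0 (last (full (suc N))) (full (suc N))
    ≡⟨ cong (λ p → F * fullColourings - weight m r s 0 p (full (suc N))) (last-full N) ⟩
      F * fullColourings - weight m r s 0 true (full (suc N))
    ≡⟨ cong (λ w → F * fullColourings - w) (weight-full m r s 0 (suc N)) ⟩
      F * fullColourings - F * (m - 1ℤ) ^ suc N
    ≡⟨ cancel F ((m - 1ℤ) ^ suc N) _ ⟩
      cycleCorrection (suc N) m r s
    ∎
    where cancel : ∀ f a b → f * (a + b) - f * a ≡ f * b
          cancel = solve-∀

-- Sums over the S ⊆ {1, …, N+1} containing N+1, weighted as on the cycle
-- (N+1 adjacent to 1) and as on the segment.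
cyclicLastSum segmentLastSum : ℕ → ℤ → ℤ → ℤ → ℤ
cyclicLastSum N m r s = ∑ N (λ S → weight m r s 0 true (S ∷ʳ true))
segmentLastSum N m r s = ∑ N (λ S → weight m r s 0 false (S ∷ʳ true))

Gcyc≡Gs+cyclicLastSum : ∀ N m r s →
  Gcyc N m r s ≡ Gs N m r s + cyclicLastSum N m r s + cycleCorrection (suc N) m r s
Gcyc≡Gs+cyclicLastSum N m r s = begin
    Gcyc N m r s
  ≡⟨ Gcyc≡∑weight N m r s ⟩
    ∑ (suc N) (λ S → weight m r s 0 (last S) S) + C
  ≡⟨ cong (_+ C) (∑-last N _) ⟩
    ∑ N (λ S → weight m r s 0 (last (S ∷ʳ false)) (S ∷ʳ false))
      + ∑ N (λ S → weight m r s 0 (last (S ∷ʳ true)) (S ∷ʳ true)) + C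
  ≡⟨ cong₂ (λ x y → x + y + C) (∑-cong N lastOut) (∑-cong N lastIn) ⟩
    ∑ N (weight m r s 0 false) + cyclicLastSum N m r s + C
  ≡⟨ cong (λ x → x + cyclicLastSum N m r s + C) (sym (Gs≡∑weight N m r s)) ⟩
    Gs N m r s + cyclicLastSum N m r s + C
  ∎
  where
  open ≡-Reasoning
  C = cycleCorrection (suc N) m r s
  lastIn : ∀ S → weight m r s 0 (last (S ∷ʳ true)) (S ∷ʳ true) ≡ weight m r s 0 true (S ∷ʳ true)
  lastIn S = cong (λ p → weight m r s 0 p (S ∷ʳ true)) (last-∷ʳ true S)
  lastOut : ∀ S → weight m r s 0 (last (S ∷ʳ false)) (S ∷ʳ false) ≡ weight m r s 0 false S
  lastOut S = trans (cong (λ p → weight m r s 0 p (S ∷ʳ false)) (last-∷ʳ false S))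
                    (weight-∷ʳ-false m r s 0 false S)

Gs-suc : ∀ N m r s → Gs (suc N) m r s ≡ Gs N m r s + segmentLastSum N m r s
Gs-suc N m r s =
  trans (Gs≡∑weight (suc N) m r s)
        (trans (∑-last N _)
               (cong (_+ segmentLastSum N m r s)
                     (trans (∑-cong N (weight-∷ʳ-false m r s 0 false)) (sym (Gs≡∑weight N m r s)))))

-- On sets containing 1 the two weights differ only in the factor m or m - 1 of 1.
segmentLastSum-suc : ∀ N m r s →
  segmentLastSum (suc N) m r s ≡ cyclicLastSum (suc N) m r s + s * r * cyclicLastSum N m (r * s) s
segmentLastSum-suc N m r s = begin
    segmentLastSum (suc N) m r s
  ≡⟨ ∑-head N _ ⟩
    P + ∑ N (λ S → s ^ 1 * r * m * weight m r s 1 true (S ∷ʳ true))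
  ≡⟨ cong (P +_) (trans (∑-*ˡ N (s ^ 1 * r * m) _) (cong (s ^ 1 * r * m *_) shifted)) ⟩
    P + s ^ 1 * r * m * T
  ≡⟨ rearrange m r s P T ⟩
    (P + s ^ 1 * r * (m - 1ℤ) * T) + s * r * T
  ≡⟨ cong (λ z → (P + z) + s * r * T) (sym (trans (∑-*ˡ N (s ^ 1 * r * (m - 1ℤ)) _) (cong (s ^ 1 * r * (m - 1ℤ) *_) shifted))) ⟩
    (P + ∑ N (λ S → s ^ 1 * r * (m - 1ℤ) * weight m r s 1 true (S ∷ʳ true))) + s * r * T
  ≡⟨ cong (_+ s * r * T) (sym (∑-head N _)) ⟩
    cyclicLastSum (suc N) m r s + s * r * cyclicLastSum N m (r * s) s
  ∎
  where
  open ≡-Reasoning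
  P = ∑ N (λ S → weight m r s 1 false (S ∷ʳ true))
  T = cyclicLastSum N m (r * s) s
  shifted : ∑ N (λ S → weight m r s 1 true (S ∷ʳ true)) ≡ T
  shifted = ∑-cong N (λ S → sym (weight-*s m r s 0 true (S ∷ʳ true)))
  rearrange : ∀ m r s p t → p + s * 1ℤ * r * m * t ≡ (p + s * 1ℤ * r * (m - 1ℤ) * t) + s * r * t
  rearrange = solve-∀

Gcyc-recurrence : ∀ N m r s →
  Gcyc (suc N) m r s ≡ Gs (suc (suc N)) m r s + r * s * (Gs N m (r * s) s - Gcyc N m (r * s) s)
Gcyc-recurrence N m r s = begin
    Gcyc (suc N) m r s
  ≡⟨ Gcyc≡Gs+cyclicLastSum (suc N) m r s ⟩
    G + B + cycleCorrection (suc (suc N)) m r s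
  ≡⟨ cong (G + B +_) (cycleCorrection-suc (suc N) m r s) ⟩
    G + B + - (r * s) * C′
  ≡⟨ rearrange r s G B B′ G′ C′ ⟩
    (G + (B + s * r * B′)) + r * s * (G′ - (G′ + B′ + C′))
  ≡⟨ sym (cong₂ (λ g c → g + r * s * (G′ - c))
                (trans (Gs-suc (suc N) m r s) (cong (G +_) (segmentLastSum-suc N m r s)))
                (Gcyc≡Gs+cyclicLastSum N m (r * s) s)) ⟩
    Gs (suc (suc N)) m r s + r * s * (G′ - Gcyc N m (r * s) s)
  ∎
  where
  open ≡-Reasoning
  G = Gs (suc N) m r s
  B = cyclicLastSum (suc N) m r s
  G′ = Gs N m (r * s) s
  B′ = cyclicLastSum N m (r * s) s
  C′ = cycleCorrection (suc N) m (r * s) s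
  rearrange : ∀ r s g b b′ g′ c′ → g + b + - (r * s) * c′ ≡ (g + (b + s * r * b′)) + r * s * (g′ - (g′ + b′ + c′))
  rearrange = solve-∀

Gcyc-zero : ∀ m r s → Gcyc 0 m r s ≡ Gs 0 m r s
Gcyc-zero m r s = trans (Gcyc≡Gs+cyclicLastSum 0 m r s) (cancel m r s (Gs 0 m r s))
  where cancel : ∀ m r s g → g + (s * 1ℤ * r * (m - 1ℤ) * 1ℤ + 0ℤ) + s * 1ℤ * r * 1ℤ * (- 1ℤ * 1ℤ * (m - 1ℤ)) ≡ g
        cancel = solve-∀

Gcyc-one : ∀ m r s → Gcyc 1 m r s ≡ Gs 2 m r s
Gcyc-one m r s =
  trans (Gcyc-recurrence 0 m r s)
        (trans (cong (λ c → Gs 2 m r s + r * s * (Gs 0 m (r * s) s - c)) (Gcyc-zero m (r * s) s))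
               (cancel r s (Gs 2 m r s) (Gs 0 m (r * s) s)))
  where cancel : ∀ r s g g′ → g + r * s * (g′ - g′) ≡ g
        cancel = solve-∀

mainTheorem5 : (n : ℕ) → 3 ≤ n → (m r s : ℤ) →
    Gc n m r s ≡ Gs n m r s + r * s * (Gs (n ∸ 2) m (r * s) s - Gc (n ∸ 1) m (r * s) s)
mainTheorem5 (suc zero) (s≤s ())
mainTheorem5 (suc (suc zero)) (s≤s (s≤s ()))
mainTheorem5 (suc (suc (suc zero))) _ m r s =
  trans (Gcyc-recurrence 1 m r s)
        (cong (λ c → Gs 3 m r s + r * s * (Gs 1 m (r * s) s - c)) (Gcyc-one m (r * s) s))
mainTheorem5 (suc (suc (suc (suc n)))) _ m r s = Gcyc-recurrence (suc (suc n)) m r s
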